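{- Let $G=(V,E_1,\dots,E_\alpha)$ be an $\alpha$-edge-colored graph, $k$ a positive integer, and $v\in V$ a vertex of total degree $2$ whose two incident edges are $(v,u)$ and $(v,w)$, both in $E_i$ for some $i\in\{1,\dots,\alpha\}$, with $u\neq w$. Let $G'$ be obtained from $G$ by setting $E_i(G')=(E_i(G)\setminus\{(v,u),(v,w)\})\cup\{(u,w)\}$ and $E_j(G')=E_j(G)$ for $j\ne i$. Then $G$ has an $\alpha$-simfvs of size at most $k$ if and only if $G'$ has an $\alpha$-simfvs of size at most $k$.
   Context: An $\alpha$-edge-colored graph is a finite undirected multigraph with edge set partitioned into $\alpha$ color classes $E_1,\dots,E_\alpha$; $G_i=(V,E_i)$. Loops and double edges count as cycles. The total degree of $v$ is $\sum_{j=1}^{\alpha} d_{G_j}(v)$. An $\alpha$-simfvs is a set $S\subseteq V$ such that $G_j\setminus S$ is a forest for every $j$. -}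

module Defs where

open import Data.Nat using (ℕ; zero; suc; _+_)
open import Data.Fin using (Fin; zero; suc; inject₁; fromℕ; _≟_)
open import Data.Fin.Subset using (Subset; _∉_)
open import Data.Fin.Subset.Properties using (_∈?_)
open import Data.List using (List; length; lookup; filter; map; tabulate)
open import Data.Nat.ListAction using (sum)
open import Data.Product using (_×_; _,_; proj₁; proj₂)
open import Data.Sum using (_⊎_)
open import Relation.Binary.PropositionalEquality using (_≡_)
open import Relation.Nullary using (¬_; Dec; yes; no; ¬?)
open import Relation.Nullary.Decidable using (_×-dec_)
open import Function.Definitions using (Injective)

-- An edge (possibly a loop) of a multigraph on vertex set Fin n; the pair is
-- read as unordered.
Edge : ℕ → Set
Edge n = Fin n × Fin n

-- A multigraph on Fin n: a list of edges (repetitions = parallel edges).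
MGraph : ℕ → Set
MGraph n = List (Edge n)

ColGraph : ℕ → ℕ → Set
ColGraph α n = Fin α → MGraph n

Joins : ∀ {n} → Edge n → Fin n → Fin n → Set
Joins e x y = (e ≡ (x , y)) ⊎ (e ≡ (y , x))

-- Loops (m = 0) and double edges (m = 1) are cycles.
record Cycle {n : ℕ} (G : MGraph n) : Set where
  field
    m      : ℕ
    vs     : Fin (suc m) → Fin n
    es     : Fin (suc m) → Fin (length G)
    vs-inj : Injective _≡_ _≡_ vs
    es-inj : Injective _≡_ _≡_ es
    step   : (i : Fin m) → Joins (lookup G (es (inject₁ i))) (vs (inject₁ i)) (vs (suc i))
    close  : Joins (lookup G (es (fromℕ m))) (vs (fromℕ m)) (vs zero)

IsForest : ∀ {n} → MGraph n → Set
IsForest G = ¬ Cycle G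

-- G \ S : delete all edges incident to a vertex of S
-- (the remaining vertices of S are isolated and irrelevant to acyclicity)
deleteVertices : ∀ {n} → Subset n → MGraph n → MGraph n
deleteVertices S G = filter (λ e → ¬? (proj₁ e ∈? S) ×-dec ¬? (proj₂ e ∈? S)) G

IsSimFVS : ∀ {α n} → ColGraph α n → Subset n → Set
IsSimFVS G S = ∀ j → IsForest (deleteVertices S (G j))

ind : ∀ {n} → Fin n → Fin n → ℕ
ind x v with x ≟ v
... | yes _ = 1
... | no  _ = 0

-- degree (a loop counts twice)
degree : ∀ {n} → MGraph n → Fin n → ℕ
degree G v = sum (map (λ e → ind (proj₁ e) v + ind (proj₂ e) v) G)

totalDegree : ∀ {α n} → ColGraph α n → Fin n → ℕ
totalDegree G v = sum (tabulate (λ j → degree (G j) v))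

module Submission where

-- The vertex v touches only e₁ = vu and e₂ = vw, both of colour i and
-- neither a loop (this is what total degree two forces).  In colour i, a cycle
-- of G through v uses both e₁ and e₂ and is shortcut by uw in G' (suppression),
-- and a cycle of G' through uw is rerouted through v in G (subdivision); all
-- other cycles are common to G and G'.  Hence a solution S of G' solves G, a
-- solution S of G with v ∉ S solves G', and if v ∈ S then (S - v) ∪ {u}, which
-- is no larger, solves G'.

open import Defs
open import Data.Empty using (⊥-elim)
open import Data.Fin using (Fin; zero; suc; inject₁; fromℕ; toℕ; _≟_; punchOut)
open import Data.Fin.Properties
  using (suc-injective; inject₁-injective; toℕ-inject₁; 0≢1+n; fromℕ≢inject₁; any?; punchOut-injective; punchIn-punchOut)
open import Data.Fin.Subset using (Subset; inside; outside; _∈_; _∉_; ∣_∣; ⁅_⁆; _∪_; _-_)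
open import Data.Fin.Subset.Properties using (_∈?_; x∈⁅x⁆; x∈p∪q⁺; x∈p∧x≢y⇒x∈p-y; x∈p⇒∣p-x∣<∣p∣; ∣⁅x⁆∣≡1)
open import Data.List using ([]; _∷_; length; lookup; tabulate; filter)
open import Data.List.Membership.Propositional.Properties using (∈-lookup)
open import Data.List.Properties using (filter-accept; filter-reject)
open import Data.List.Relation.Binary.Permutation.Homogeneous using (onIndices)
open import Data.List.Relation.Binary.Permutation.Propositional using (_↭_; ↭⇒↭ₛ; ↭-swap; ↭-refl; ↭-sym)
open import Data.List.Relation.Binary.Permutation.Propositional.Properties using (map⁺; filter-↭)
open import Data.List.Relation.Binary.Sublist.Propositional using (_⊆_; _∷_; _∷ʳ_; ⊆-refl; ⊆-trans)
open import Data.List.Relation.Binary.Sublist.Propositional.Properties using (filter-⊆; filter⁺; All-resp-⊆)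
open import Data.List.Relation.Unary.All as All using (All; []; _∷_)
open import Data.Nat using (ℕ; zero; suc; _+_; _≤_; _<_; s≤s)
import Data.Nat.Properties as ℕ
open import Data.Nat.ListAction using (sum)
open import Data.Nat.ListAction.Properties using (sum-↭)
import Data.Product as Product
open import Data.Product using (Σ; Σ-syntax; ∃; _×_; _,_; proj₁; proj₂)
open import Data.Sum using (_⊎_; inj₁; inj₂)
open import Data.Vec using ([]; _∷_)
open import Function using (_∘_)
open import Function.Bundles using (Inverse; Injection; _⇔_; mk⇔)
open import Function.Definitions using (Injective)
open import Function.Properties.Inverse using (Inverse⇒Injection)
open import Relation.Binary.PropositionalEquality
  using (_≡_; _≢_; refl; sym; trans; cong; cong₂; subst; setoid; module ≡-Reasoning)
open import Relation.Nullary using (¬_; Dec; yes; no; ¬?)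
open import Relation.Nullary.Decidable using (_⊎-dec_; _×-dec_)
open import Relation.Unary using (Decidable)

data LastOrInject : ∀ {m} → Fin (suc m) → Set where
  last   : ∀ {m} → LastOrInject (fromℕ m)
  inject : ∀ {m} (i : Fin m) → LastOrInject (inject₁ i)

lastOrInject : ∀ {m} (j : Fin (suc m)) → LastOrInject j
lastOrInject {zero}  zero    = last
lastOrInject {suc m} zero    = inject zero
lastOrInject {suc m} (suc j) with lastOrInject j
... | last     = last
... | inject i = inject (suc i)

extend : ∀ {m} {A : Set} → (Fin m → A) → A → Fin (suc m) → A
extend {zero}  f a zero    = a
extend {suc m} f a zero    = f zero
extend {suc m} f a (suc j) = extend (f ∘ suc) a j

extend-last : ∀ {m} {A : Set} (f : Fin m → A) a → extend f a (fromℕ m) ≡ a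
extend-last {zero}  f a = refl
extend-last {suc m} f a = extend-last (f ∘ suc) a

extend-inject : ∀ {m} {A : Set} (f : Fin m → A) a i → extend f a (inject₁ i) ≡ f i
extend-inject {suc m} f a zero    = refl
extend-inject {suc m} f a (suc i) = extend-inject (f ∘ suc) a i

extend-injective : ∀ {m} {A : Set} {f : Fin m → A} {a : A} →
  Injective _≡_ _≡_ f → (∀ i → f i ≢ a) → Injective _≡_ _≡_ (extend f a)
extend-injective {f = f} {a} f-inj fresh {x} {y} eq
  with lastOrInject x | lastOrInject y
... | last     | last     = refl
... | last     | inject j =
  ⊥-elim (fresh j (trans (sym (extend-inject f a j)) (trans (sym eq) (extend-last f a))))
... | inject i | last     =
  ⊥-elim (fresh i (trans (sym (extend-inject f a i)) (trans eq (extend-last f a))))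
... | inject i | inject j =
  cong inject₁ (f-inj (trans (sym (extend-inject f a i)) (trans eq (extend-inject f a j))))

csuc : ∀ {m} → Fin (suc m) → Fin (suc m)
csuc = extend suc zero

csuc-last : ∀ m → csuc (fromℕ m) ≡ zero
csuc-last m = extend-last suc zero

csuc-inject : ∀ {m} (i : Fin m) → csuc (inject₁ i) ≡ suc i
csuc-inject i = extend-inject suc zero i

csuc-injective : ∀ {m} → Injective _≡_ _≡_ (csuc {m})
csuc-injective = extend-injective suc-injective (λ i → 0≢1+n ∘ sym)

-- Iterated cyclic successor; rotations of a cycle are reindexings along it.
csuc^ : ∀ {m} → ℕ → Fin (suc m) → Fin (suc m)
csuc^ zero    j = j
csuc^ (suc k) j = csuc (csuc^ k j)

csuc^-csuc : ∀ {m} k (j : Fin (suc m)) → csuc^ k (csuc j) ≡ csuc (csuc^ k j)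
csuc^-csuc zero    j = refl
csuc^-csuc (suc k) j = cong csuc (csuc^-csuc k j)

csuc^-injective : ∀ {m} k → Injective _≡_ _≡_ (csuc^ {m} k)
csuc^-injective zero    eq = eq
csuc^-injective (suc k) eq = csuc^-injective k (csuc-injective eq)

csuc^-from-last : ∀ {m} k (t : Fin (suc m)) → toℕ t ≡ k → csuc^ (suc k) (fromℕ m) ≡ t
csuc^-from-last {m}     zero    zero    _  = csuc-last m
csuc^-from-last {suc m} (suc k) (suc i) eq =
  trans (cong csuc (csuc^-from-last k (inject₁ i) (trans (toℕ-inject₁ i) (ℕ.suc-injective eq))))
        (csuc-inject i)

Joins-resp : ∀ {n} {e e' : Edge n} {a a' b b'} → e ≡ e' → a ≡ a' → b ≡ b' → Joins e a b → Joins e' a' b'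
Joins-resp refl refl refl j = j

Joins-sym : ∀ {n} {e : Edge n} {a b} → Joins e a b → Joins e b a
Joins-sym (inj₁ eq) = inj₂ eq
Joins-sym (inj₂ eq) = inj₁ eq

-- A cycle of length suc m in cyclic form: edge es j joins vs j to vs (csuc j),
-- so no index plays the special role of the closing edge of Defs.Cycle.
record CyclicCycle {n : ℕ} (H : MGraph n) (m : ℕ) : Set where
  field
    vs     : Fin (suc m) → Fin n
    es     : Fin (suc m) → Fin (length H)
    vs-inj : Injective _≡_ _≡_ vs
    es-inj : Injective _≡_ _≡_ es
    joins  : ∀ j → Joins (lookup H (es j)) (vs j) (vs (csuc j))

HasCycle : ∀ {n} → MGraph n → Set
HasCycle H = Σ ℕ (CyclicCycle H)

module _ {n : ℕ} {H : MGraph n} where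

  cycle⇒cyclic : Cycle H → HasCycle H
  cycle⇒cyclic c = m , record
    { vs = vs ; es = es ; vs-inj = vs-inj ; es-inj = es-inj ; joins = joins }
    where
    open Cycle c
    joins : ∀ j → Joins (lookup H (es j)) (vs j) (vs (csuc j))
    joins j with lastOrInject j
    ... | last     = Joins-resp refl refl (cong vs (sym (csuc-last m))) close
    ... | inject i = Joins-resp refl refl (cong vs (sym (csuc-inject i))) (step i)

  cyclic⇒cycle : HasCycle H → Cycle H
  cyclic⇒cycle (m , C) = record
    { m = m ; vs = vs ; es = es ; vs-inj = vs-inj ; es-inj = es-inj
    ; step  = λ i → Joins-resp refl refl (cong vs (csuc-inject i)) (joins (inject₁ i))
    ; close = Joins-resp refl refl (cong vs (csuc-last m)) (joins (fromℕ m)) }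
    where open CyclicCycle C

forest-reflect : ∀ {n} {A B : MGraph n} → (HasCycle A → HasCycle B) → IsForest B → IsForest A
forest-reflect f forestB c = forestB (cyclic⇒cycle (f (cycle⇒cyclic c)))

module _ {n : ℕ} {H H' : MGraph n} where

  relabel : ∀ {m} (C : CyclicCycle H m) (es' : Fin (suc m) → Fin (length H')) →
    Injective _≡_ _≡_ es' → (∀ j → lookup H' (es' j) ≡ lookup H (CyclicCycle.es C j)) →
    CyclicCycle H' m
  relabel C es' es'-inj same = record
    { vs = vs ; es = es' ; vs-inj = vs-inj ; es-inj = es'-inj
    ; joins = λ j → Joins-resp (sym (same j)) refl refl (joins j) }
    where open CyclicCycle C

  reindex : (f : Fin (length H) → Fin (length H')) → Injective _≡_ _≡_ f →
    (∀ p → lookup H' (f p) ≡ lookup H p) → HasCycle H → HasCycle H'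
  reindex f f-inj same (m , C) =
    m , relabel C (f ∘ es) (es-inj ∘ f-inj) (same ∘ es)
    where open CyclicCycle C

module _ {n : ℕ} {H : MGraph n} where

  rotate : ∀ {m} (C : CyclicCycle H m) (t : Fin (suc m)) → Σ[ C' ∈ CyclicCycle H m ]
    (CyclicCycle.vs C' (fromℕ m) ≡ CyclicCycle.vs C t × CyclicCycle.es C' (fromℕ m) ≡ CyclicCycle.es C t)
  rotate {m} C t = C' , cong vs to-t , cong es to-t
    where
    open CyclicCycle C
    k   = suc (toℕ t)
    to-t = csuc^-from-last (toℕ t) t refl
    C' : CyclicCycle H m
    C' = record
      { vs = vs ∘ csuc^ k ; es = es ∘ csuc^ k
      ; vs-inj = csuc^-injective k ∘ vs-inj ; es-inj = csuc^-injective k ∘ es-inj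
      ; joins = λ j → Joins-resp refl refl (cong vs (sym (csuc^-csuc k j))) (joins (csuc^ k j)) }

  rotate-to : ∀ {m v} (C : CyclicCycle H m) → ∃ (λ t → CyclicCycle.vs C t ≡ v) →
    Σ[ C' ∈ CyclicCycle H m ] CyclicCycle.vs C' (fromℕ m) ≡ v
  rotate-to C (t , vt≡v) = proj₁ (rotate C t) , trans (proj₁ (proj₂ (rotate C t))) vt≡v

module _ {n : ℕ} {A B : MGraph n} where

  cycle-↭ : A ↭ B → HasCycle A → HasCycle B
  cycle-↭ p = reindex (Inverse.to π) (Injection.injective (Inverse⇒Injection π))
                      (sym ∘ onIndices-lookup (↭⇒↭ₛ p))
    where
    open import Data.List.Relation.Binary.Permutation.Setoid.Properties (setoid (Edge n))
      using (onIndices-lookup)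
    π = onIndices (↭⇒↭ₛ p)

module _ {n : ℕ} where

  ⊆-position : {A B : MGraph n} → A ⊆ B → Fin (length A) → Fin (length B)
  ⊆-position (y ∷ʳ τ)   p       = suc (⊆-position τ p)
  ⊆-position (refl ∷ τ) zero    = zero
  ⊆-position (refl ∷ τ) (suc p) = suc (⊆-position τ p)

  ⊆-position-injective : {A B : MGraph n} (τ : A ⊆ B) → Injective _≡_ _≡_ (⊆-position τ)
  ⊆-position-injective (y ∷ʳ τ)   eq = ⊆-position-injective τ (suc-injective eq)
  ⊆-position-injective (refl ∷ τ) {zero}  {zero}  eq = refl
  ⊆-position-injective (refl ∷ τ) {suc p} {suc q} eq =
    cong suc (⊆-position-injective τ (suc-injective eq))

  ⊆-position-lookup : {A B : MGraph n} (τ : A ⊆ B) (p : Fin (length A)) →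
    lookup B (⊆-position τ p) ≡ lookup A p
  ⊆-position-lookup (y ∷ʳ τ)   p       = ⊆-position-lookup τ p
  ⊆-position-lookup (refl ∷ τ) zero    = refl
  ⊆-position-lookup (refl ∷ τ) (suc p) = ⊆-position-lookup τ p

  cycle-⊆ : {A B : MGraph n} → A ⊆ B → HasCycle A → HasCycle B
  cycle-⊆ τ = reindex (⊆-position τ) (⊆-position-injective τ) (⊆-position-lookup τ)

Touches : ∀ {n} → Edge n → Fin n → Set
Touches e v = ∃ (Joins e v)

Avoids : ∀ {n} → Fin n → MGraph n → Set
Avoids v = All (λ e → ¬ Touches e v)

module _ {n : ℕ} where

  avoids-lookup : ∀ {v : Fin n} {L : MGraph n} → Avoids v L → ∀ p → ¬ Touches (lookup L p) v
  avoids-lookup av p = All.lookup av (∈-lookup p)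

  joins-endpoint : ∀ {e : Edge n} {a b v z} → Joins e a b → Joins e v z → v ≡ a ⊎ v ≡ b
  joins-endpoint (inj₁ refl) (inj₁ refl) = inj₁ refl
  joins-endpoint (inj₁ refl) (inj₂ refl) = inj₂ refl
  joins-endpoint (inj₂ refl) (inj₁ refl) = inj₂ refl
  joins-endpoint (inj₂ refl) (inj₂ refl) = inj₁ refl

  joins-other : ∀ {e : Edge n} {v a b} → Joins e v a → Joins e v b → a ≢ v → b ≡ a
  joins-other (inj₁ refl) (inj₁ refl) _   = refl
  joins-other (inj₁ refl) (inj₂ refl) a≢v = ⊥-elim (a≢v refl)
  joins-other (inj₂ refl) (inj₁ refl) a≢v = ⊥-elim (a≢v refl)
  joins-other (inj₂ refl) (inj₂ refl) _   = refl

  joins-pair : ∀ {u w a b : Fin n} → Joins (u , w) a b → (a ≡ u × b ≡ w) ⊎ (a ≡ w × b ≡ u)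
  joins-pair (inj₁ refl) = inj₁ (refl , refl)
  joins-pair (inj₂ refl) = inj₂ (refl , refl)

  edge-at-v : ∀ {v x z : Fin n} {e : Edge n} {L : MGraph n} →
    Joins e v x → x ≢ v → Avoids v L →
    ∀ p → Joins (lookup (e ∷ L) p) v z → p ≡ zero × z ≡ x
  edge-at-v je x≢v av zero    jz = refl , joins-other je jz x≢v
  edge-at-v je x≢v av (suc q) jz = ⊥-elim (avoids-lookup av q (_ , jz))

  edges-at-v : ∀ {v u w z : Fin n} {e₁ e₂ : Edge n} {L : MGraph n} →
    Joins e₁ v u → Joins e₂ v w → u ≢ v → w ≢ v → Avoids v L →
    ∀ p → Joins (lookup (e₁ ∷ e₂ ∷ L) p) v z → (p ≡ zero × z ≡ u) ⊎ (p ≡ suc zero × z ≡ w)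
  edges-at-v je₁ je₂ u≢v w≢v av zero    jz = inj₁ (refl , joins-other je₁ jz u≢v)
  edges-at-v je₁ je₂ u≢v w≢v av (suc q) jz =
    inj₂ (Product.map₁ (cong suc) (edge-at-v je₂ w≢v av q jz))

module _ {n : ℕ} {H : MGraph n} {m : ℕ} (C : CyclicCycle H m) where
  open CyclicCycle C

  off-cycle : ∀ {v} → (∀ t → vs t ≢ v) → ∀ j → ¬ Touches (lookup H (es j)) v
  off-cycle off j (z , jz) with joins-endpoint (joins j) jz
  ... | inj₁ eq = off j (sym eq)
  ... | inj₂ eq = off (csuc j) (sym eq)

  off-cycle-unused : ∀ {v p} → (∀ t → vs t ≢ v) → Touches (lookup H p) v → ∀ j → es j ≢ p
  off-cycle-unused {v} off touch j refl = off-cycle off j touch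

  avoids-off-cycle : ∀ {v} → Avoids v H → ∀ t → vs t ≢ v
  avoids-off-cycle av t refl = avoids-lookup av (es t) (_ , joins t)

  last-edge : Joins (lookup H (es (fromℕ m))) (vs (fromℕ m)) (vs zero)
  last-edge = Joins-resp refl refl (cong vs (csuc-last m)) (joins (fromℕ m))

module _ {n : ℕ} {H : MGraph n} {m : ℕ} (C : CyclicCycle H (suc m)) where
  open CyclicCycle C

  prev-edge : Joins (lookup H (es (inject₁ (fromℕ m)))) (vs (inject₁ (fromℕ m))) (vs (fromℕ (suc m)))
  prev-edge = Joins-resp refl refl (cong vs (csuc-inject (fromℕ m))) (joins (inject₁ (fromℕ m)))

  last≢prev : es (fromℕ (suc m)) ≢ es (inject₁ (fromℕ m))
  last≢prev eq = fromℕ≢inject₁ (es-inj eq)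

module _ {n : ℕ} {x : Edge n} {L : MGraph n} where

  drop-head : ∀ {m} (C : CyclicCycle (x ∷ L) m) → (∀ j → CyclicCycle.es C j ≢ zero) → CyclicCycle L m
  drop-head C unused = relabel C (λ j → punchOut (unused j ∘ sym))
    (λ {i} {j} eq → es-inj (punchOut-injective (unused i ∘ sym) (unused j ∘ sym) eq))
    (λ j → cong (lookup (x ∷ L)) (punchIn-punchOut (unused j ∘ sym)))
    where open CyclicCycle C

module _ {n : ℕ} {v x : Fin n} {e : Edge n} {L : MGraph n}
         (je : Joins e v x) (x≢v : x ≢ v) (av : Avoids v L) where

  -- A pendant vertex lies on no cycle: both of its cycle edges would be e.
  pendant-off-cycle : ∀ m (C : CyclicCycle (e ∷ L) m) → CyclicCycle.vs C (fromℕ m) ≢ v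
  pendant-off-cycle zero C v-last =
    x≢v (sym (proj₂ (edge-at-v je x≢v av (es (fromℕ 0)) (Joins-resp refl v-last v-last (last-edge C)))))
    where open CyclicCycle C
  pendant-off-cycle (suc m) C v-last = last≢prev C (trans at-last (sym at-prev))
    where
    open CyclicCycle C
    at-last = proj₁ (edge-at-v je x≢v av (es (fromℕ (suc m))) (Joins-resp refl v-last refl (last-edge C)))
    at-prev = proj₁ (edge-at-v je x≢v av (es (inject₁ (fromℕ m))) (Joins-resp refl v-last refl (Joins-sym (prev-edge C))))

  pendant : HasCycle (e ∷ L) → HasCycle L
  pendant (m , C) with any? (λ t → vs t ≟ v)
    where open CyclicCycle C
  ... | yes on = ⊥-elim (pendant-off-cycle m (proj₁ (rotate-to C on)) (proj₂ (rotate-to C on)))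
  ... | no on = m , drop-head C (off-cycle-unused C (λ t eq → on (t , eq)) (x , je))

-- Position bookkeeping between f ∷ L and x ∷ y ∷ L, sharing the tail L:
-- subdivision sends the head f to x, suppression merges both heads x, y into f.
module _ {k : ℕ} where

  expand : Fin (suc k) → Fin (suc (suc k))
  expand zero    = zero
  expand (suc p) = suc (suc p)

  expand-injective : Injective _≡_ _≡_ expand
  expand-injective {zero}  {zero}  _  = refl
  expand-injective {suc p} {suc q} eq = cong suc (suc-injective (suc-injective eq))

  expand≢1 : ∀ p → expand p ≢ suc zero
  expand≢1 zero    ()
  expand≢1 (suc p) ()

  Head₂ : Fin (suc (suc k)) → Set
  Head₂ p = p ≡ zero ⊎ p ≡ suc zero

  merge : Fin (suc (suc k)) → Fin (suc k)
  merge zero          = zero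
  merge (suc zero)    = zero
  merge (suc (suc p)) = suc p

  merge-head : ∀ {p} → Head₂ p → merge p ≡ zero
  merge-head (inj₁ refl) = refl
  merge-head (inj₂ refl) = refl

  merge≡0 : ∀ p → merge p ≡ zero → Head₂ p
  merge≡0 zero       _ = inj₁ refl
  merge≡0 (suc zero) _ = inj₂ refl

  merge-injective : ∀ {p q} → ¬ Head₂ p → ¬ Head₂ q → merge p ≡ merge q → p ≡ q
  merge-injective {zero}        h _ _ = ⊥-elim (h (inj₁ refl))
  merge-injective {suc zero}    h _ _ = ⊥-elim (h (inj₂ refl))
  merge-injective {suc (suc p)} {zero}        _ h _ = ⊥-elim (h (inj₁ refl))
  merge-injective {suc (suc p)} {suc zero}    _ h _ = ⊥-elim (h (inj₂ refl))
  merge-injective {suc (suc p)} {suc (suc q)} _ _ eq = cong (λ r → suc (suc r)) (suc-injective eq)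

module _ {n : ℕ} {f x y : Edge n} {L : MGraph n} where

  expand-lookup : ∀ p → p ≢ zero → lookup (x ∷ y ∷ L) (expand p) ≡ lookup (f ∷ L) p
  expand-lookup zero    p≢0 = ⊥-elim (p≢0 refl)
  expand-lookup (suc p) _   = refl

  merge-lookup : ∀ p → ¬ Head₂ p → lookup (f ∷ L) (merge p) ≡ lookup (x ∷ y ∷ L) p
  merge-lookup zero          h = ⊥-elim (h (inj₁ refl))
  merge-lookup (suc zero)    h = ⊥-elim (h (inj₂ refl))
  merge-lookup (suc (suc p)) _ = refl

  subdivide-last : ∀ {m} {v : Fin n} (C : CyclicCycle (f ∷ L) m) →
    CyclicCycle.es C (fromℕ m) ≡ zero → (∀ t → CyclicCycle.vs C t ≢ v) →
    Joins x v (CyclicCycle.vs C (fromℕ m)) → Joins y v (CyclicCycle.vs C zero) →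
    CyclicCycle (x ∷ y ∷ L) (suc m)
  subdivide-last {m} {v} C last-head off jx jy = record
    { vs = vs' ; es = es'
    ; vs-inj = extend-injective vs-inj off
    ; es-inj = extend-injective (es-inj ∘ expand-injective) (expand≢1 ∘ es)
    ; joins = joins' }
    where
    open CyclicCycle C
    vs' : Fin (suc (suc m)) → Fin n
    vs' = extend vs v
    es' : Fin (suc (suc m)) → Fin (length (x ∷ y ∷ L))
    es' = extend (expand ∘ es) (suc zero)

    inner-not-head : ∀ i → es (inject₁ i) ≢ zero
    inner-not-head i eq = fromℕ≢inject₁ (es-inj (trans last-head (sym eq)))

    joins' : ∀ j → Joins (lookup (x ∷ y ∷ L) (es' j)) (vs' j) (vs' (csuc j))
    joins' j with lastOrInject j
    ... | last = Joins-resp (cong (lookup (x ∷ y ∷ L)) (sym (extend-last (expand ∘ es) (suc zero))))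
                            (sym (extend-last vs v)) (cong vs' (sym (csuc-last (suc m)))) jy
    ... | inject j' with lastOrInject j'
    ...   | last = Joins-resp
                (cong (lookup (x ∷ y ∷ L))
                      (sym (trans (extend-inject (expand ∘ es) (suc zero) (fromℕ m)) (cong expand last-head))))
                (sym (extend-inject vs v (fromℕ m)))
                (trans (sym (extend-last vs v)) (cong vs' (sym (csuc-inject (fromℕ m)))))
                (Joins-sym jx)
    ...   | inject i = Joins-resp
                (trans (sym (expand-lookup (es (inject₁ i)) (inner-not-head i)))
                       (cong (lookup (x ∷ y ∷ L)) (sym (extend-inject (expand ∘ es) (suc zero) (inject₁ i)))))
                (sym (extend-inject vs v (inject₁ i)))
                (trans (cong vs (csuc-inject i))
                       (trans (sym (extend-inject vs v (suc i))) (cong vs' (sym (csuc-inject (inject₁ i))))))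
                (joins (inject₁ i))

  suppress-last : ∀ {m} (C : CyclicCycle (x ∷ y ∷ L) (suc m)) →
    let open CyclicCycle C in
    Head₂ (es (inject₁ (fromℕ m))) →
    (∀ j → Head₂ (es j) → j ≡ fromℕ (suc m) ⊎ j ≡ inject₁ (fromℕ m)) →
    Joins f (vs (inject₁ (fromℕ m))) (vs zero) → CyclicCycle (f ∷ L) m
  suppress-last {m} C prev-head only-last-two jf = record
    { vs = vs ∘ inject₁ ; es = es'
    ; vs-inj = inject₁-injective ∘ vs-inj
    ; es-inj = es'-inj ; joins = joins' }
    where
    open CyclicCycle C
    es' : Fin (suc m) → Fin (length (f ∷ L))
    es' = merge ∘ es ∘ inject₁

    head-only-at-prev : ∀ i → Head₂ (es (inject₁ i)) → i ≡ fromℕ m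
    head-only-at-prev i h with only-last-two (inject₁ i) h
    ... | inj₁ eq = ⊥-elim (fromℕ≢inject₁ (sym eq))
    ... | inj₂ eq = inject₁-injective eq

    head₂? : ∀ i → Dec (Head₂ (es (inject₁ i)))
    head₂? i = (es (inject₁ i) ≟ zero) ⊎-dec (es (inject₁ i) ≟ suc zero)

    es'-inj : Injective _≡_ _≡_ es'
    es'-inj {i} {j} eq with head₂? i | head₂? j
    ... | yes hi | yes hj = trans (head-only-at-prev i hi) (sym (head-only-at-prev j hj))
    ... | yes hi | no ¬hj = ⊥-elim (¬hj (merge≡0 _ (trans (sym eq) (merge-head hi))))
    ... | no ¬hi | yes hj = ⊥-elim (¬hi (merge≡0 _ (trans eq (merge-head hj))))
    ... | no ¬hi | no ¬hj = inject₁-injective (es-inj (merge-injective ¬hi ¬hj eq))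

    joins' : ∀ j → Joins (lookup (f ∷ L) (es' j)) (vs (inject₁ j)) (vs (inject₁ (csuc j)))
    joins' j with lastOrInject j
    ... | last = Joins-resp (cong (lookup (f ∷ L)) (sym (merge-head prev-head))) refl
                            (cong (vs ∘ inject₁) (sym (csuc-last m))) jf
    ... | inject i = Joins-resp (sym (merge-lookup _ inner-not-head)) refl
                                (trans (cong vs (csuc-inject (inject₁ i))) (cong (vs ∘ inject₁) (sym (csuc-inject i))))
                                (joins (inject₁ (inject₁ i)))
      where
      inner-not-head : ¬ Head₂ (es (inject₁ (inject₁ i)))
      inner-not-head h = fromℕ≢inject₁ (sym (head-only-at-prev (inject₁ i) h))

module Suppression {n : ℕ} {v u w : Fin n} {e₁ e₂ : Edge n} {L : MGraph n}
  (je₁ : Joins e₁ v u) (je₂ : Joins e₂ v w) (u≢v : u ≢ v) (w≢v : w ≢ v) (av : Avoids v L) where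

  shortcut-at-v : ∀ m (C : CyclicCycle (e₁ ∷ e₂ ∷ L) m) → CyclicCycle.vs C (fromℕ m) ≡ v →
    HasCycle ((u , w) ∷ L)
  shortcut-at-v zero C v-last
    with edges-at-v je₁ je₂ u≢v w≢v av (es (fromℕ 0)) (Joins-resp refl v-last v-last (last-edge C))
    where open CyclicCycle C
  ... | inj₁ (_ , v≡u) = ⊥-elim (u≢v (sym v≡u))
  ... | inj₂ (_ , v≡w) = ⊥-elim (w≢v (sym v≡w))
  shortcut-at-v (suc m) C v-last
    with edges-at-v je₁ je₂ u≢v w≢v av (es (fromℕ (suc m))) (Joins-resp refl v-last refl (last-edge C))
       | edges-at-v je₁ je₂ u≢v w≢v av (es (inject₁ (fromℕ m))) (Joins-resp refl v-last refl (Joins-sym (prev-edge C)))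
    where open CyclicCycle C
  ... | inj₁ (l≡0 , _) | inj₁ (p≡0 , _) = ⊥-elim (last≢prev C (trans l≡0 (sym p≡0)))
  ... | inj₂ (l≡1 , _) | inj₂ (p≡1 , _) = ⊥-elim (last≢prev C (trans l≡1 (sym p≡1)))
  ... | inj₁ (l≡0 , first≡u) | inj₂ (p≡1 , prev≡w) =
    m , suppress-last C (inj₂ p≡1) only-last-two (inj₂ (cong₂ _,_ (sym first≡u) (sym prev≡w)))
    where
    open CyclicCycle C
    only-last-two : ∀ j → Head₂ (es j) → j ≡ fromℕ (suc m) ⊎ j ≡ inject₁ (fromℕ m)
    only-last-two j (inj₁ j≡0) = inj₁ (es-inj (trans j≡0 (sym l≡0)))
    only-last-two j (inj₂ j≡1) = inj₂ (es-inj (trans j≡1 (sym p≡1)))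
  ... | inj₂ (l≡1 , first≡w) | inj₁ (p≡0 , prev≡u) =
    m , suppress-last C (inj₁ p≡0) only-last-two (inj₁ (cong₂ _,_ (sym prev≡u) (sym first≡w)))
    where
    open CyclicCycle C
    only-last-two : ∀ j → Head₂ (es j) → j ≡ fromℕ (suc m) ⊎ j ≡ inject₁ (fromℕ m)
    only-last-two j (inj₁ j≡0) = inj₂ (es-inj (trans j≡0 (sym p≡0)))
    only-last-two j (inj₂ j≡1) = inj₁ (es-inj (trans j≡1 (sym l≡1)))

  -- Suppressing v keeps cycles: a cycle through v uses both e₁ and e₂ and is
  -- shortcut by uw.
  suppress : HasCycle (e₁ ∷ e₂ ∷ L) → HasCycle ((u , w) ∷ L)
  suppress (m , C) with any? (λ t → vs t ≟ v)
    where open CyclicCycle C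
  ... | yes on = shortcut-at-v m (proj₁ (rotate-to C on)) (proj₂ (rotate-to C on))
  ... | no on = cycle-⊆ ((u , w) ∷ʳ ⊆-refl) (m , drop-head (drop-head C e₁-unused) e₂-unused)
    where
    open CyclicCycle C
    off : ∀ t → vs t ≢ v
    off t eq = on (t , eq)
    e₁-unused : ∀ j → es j ≢ zero
    e₁-unused = off-cycle-unused C off (u , je₁)
    e₂-unused : ∀ j → CyclicCycle.es (drop-head C e₁-unused) j ≢ zero
    e₂-unused j eq = off-cycle-unused C off (w , je₂) j
      (trans (sym (punchIn-punchOut (e₁-unused j ∘ sym))) (cong suc eq))

  uw-avoids : ¬ Touches (u , w) v
  uw-avoids (_ , j) with joins-endpoint (inj₁ refl) j
  ... | inj₁ v≡u = u≢v (sym v≡u)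
  ... | inj₂ v≡w = w≢v (sym v≡w)

  -- Subdividing uw by v keeps cycles: a cycle using uw is rerouted through v,
  -- choosing the order of e₁, e₂ by the direction in which uw is traversed.
  subdivide : HasCycle ((u , w) ∷ L) → HasCycle (e₁ ∷ e₂ ∷ L)
  subdivide (m , C) with any? (λ j → es j ≟ zero)
    where open CyclicCycle C
  ... | no unused = cycle-⊆ (e₁ ∷ʳ e₂ ∷ʳ ⊆-refl) (m , drop-head C (λ j eq → unused (j , eq)))
  ... | yes (t , t-head) with rotate C t
  ...   | C' , _ , at-t with joins-pair (Joins-resp (cong (lookup ((u , w) ∷ L)) (trans at-t t-head)) refl refl (last-edge C'))
  ...     | inj₁ (last≡u , first≡w) =
    suc m , subdivide-last C' (trans at-t t-head) off
              (Joins-resp refl refl (sym last≡u) je₁) (Joins-resp refl refl (sym first≡w) je₂)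
    where off = avoids-off-cycle C' (uw-avoids ∷ av)
  ...     | inj₂ (last≡w , first≡u) = cycle-↭ (↭-swap e₂ e₁ ↭-refl)
    (suc m , subdivide-last C' (trans at-t t-head) off
              (Joins-resp refl refl (sym last≡w) je₂) (Joins-resp refl refl (sym first≡u) je₁))
    where off = avoids-off-cycle C' (uw-avoids ∷ av)

module _ {n : ℕ} where

  ind-self : (v : Fin n) → ind v v ≡ 1
  ind-self v with v ≟ v
  ... | yes _   = refl
  ... | no v≢v = ⊥-elim (v≢v refl)

  ind≡0⇒≢ : (a v : Fin n) → ind a v ≡ 0 → a ≢ v
  ind≡0⇒≢ a v h a≡v with a ≟ v
  ... | yes _   = ℕ.0≢1+n (sym h)
  ... | no a≢v = a≢v a≡v

  incidence : Fin n → Edge n → ℕ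
  incidence v e = ind (proj₁ e) v + ind (proj₂ e) v

  incidence-joins : ∀ {e : Edge n} {v x} → Joins e v x → incidence v e ≡ suc (ind x v)
  incidence-joins {v = v} {x} (inj₁ refl) = cong (_+ ind x v) (ind-self v)
  incidence-joins {v = v} {x} (inj₂ refl) = trans (cong (ind x v +_) (ind-self v)) (ℕ.+-comm (ind x v) 1)

  degree≡0⇒avoids : (L : MGraph n) (v : Fin n) → degree L v ≡ 0 → Avoids v L
  degree≡0⇒avoids []      v _ = []
  degree≡0⇒avoids (e ∷ L) v h =
    (λ (_ , j) → ℕ.0≢1+n (trans (sym (ℕ.m+n≡0⇒m≡0 (incidence v e) h)) (incidence-joins j)))
    ∷ degree≡0⇒avoids L v (ℕ.m+n≡0⇒n≡0 (incidence v e) h)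

  degree-↭ : ∀ {A B : MGraph n} (v : Fin n) → A ↭ B → degree A v ≡ degree B v
  degree-↭ v p = sum-↭ (map⁺ (incidence v) p)

term≤sum : ∀ {α} (f : Fin α → ℕ) i → f i ≤ sum (tabulate f)
term≤sum f zero    = ℕ.m≤m+n _ _
term≤sum f (suc i) = ℕ.≤-trans (term≤sum (f ∘ suc) i) (ℕ.m≤n+m _ (f zero))

two-terms≤sum : ∀ {α} (f : Fin α → ℕ) i j → i ≢ j → f i + f j ≤ sum (tabulate f)
two-terms≤sum f zero    zero    i≢j = ⊥-elim (i≢j refl)
two-terms≤sum f zero    (suc j) _   = ℕ.+-monoʳ-≤ (f zero) (term≤sum (f ∘ suc) j)
two-terms≤sum f (suc i) zero    _   =
  ℕ.≤-trans (ℕ.≤-reflexive (ℕ.+-comm (f (suc i)) (f zero))) (ℕ.+-monoʳ-≤ (f zero) (term≤sum (f ∘ suc) i))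
two-terms≤sum f (suc i) (suc j) i≢j =
  ℕ.≤-trans (two-terms≤sum (f ∘ suc) i j (i≢j ∘ cong suc)) (ℕ.m≤n+m _ (f zero))

degree-two : ∀ {α n} (G : ColGraph α n) (i : Fin α) {v u w : Fin n} {e₁ e₂ : Edge n} {rest : MGraph n} →
  totalDegree G v ≡ 2 → G i ↭ e₁ ∷ e₂ ∷ rest → Joins e₁ v u → Joins e₂ v w →
  u ≢ v × w ≢ v × Avoids v rest × (∀ j → j ≢ i → Avoids v (G j))
degree-two G i {v} {u} {w} {e₁} {e₂} {rest} total p je₁ je₂ =
  ind≡0⇒≢ u v (ℕ.m+n≡0⇒m≡0 _ extra≡0) ,
  ind≡0⇒≢ w v (ℕ.m+n≡0⇒m≡0 _ (ℕ.m+n≡0⇒n≡0 (ind u v) extra≡0)) ,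
  degree≡0⇒avoids rest v (ℕ.m+n≡0⇒n≡0 (ind w v) (ℕ.m+n≡0⇒n≡0 (ind u v) extra≡0)) ,
  λ j j≢i → degree≡0⇒avoids (G j) v (ℕ.n≤0⇒n≡0 (ℕ.+-cancelˡ-≤ 2 _ _ (others j j≢i)))
  where
  d : Fin _ → ℕ
  d j = degree (G j) v
  extra : ℕ
  extra = ind u v + (ind w v + degree rest v)

  dᵢ≡2+extra : d i ≡ 2 + extra
  dᵢ≡2+extra = begin
    d i                                                ≡⟨ degree-↭ v p ⟩
    incidence v e₁ + (incidence v e₂ + degree rest v)  ≡⟨ cong₂ (λ a b → a + (b + degree rest v)) (incidence-joins je₁) (incidence-joins je₂) ⟩
    suc (ind u v) + (suc (ind w v) + degree rest v)    ≡⟨ cong suc (ℕ.+-suc (ind u v) _) ⟩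
    2 + extra                                          ∎
    where open ≡-Reasoning

  extra≡0 : extra ≡ 0
  extra≡0 = ℕ.n≤0⇒n≡0 (ℕ.+-cancelˡ-≤ 2 _ _
    (subst (_≤ 2) dᵢ≡2+extra (ℕ.≤-trans (term≤sum d i) (ℕ.≤-reflexive total))))

  others : ∀ j → j ≢ i → 2 + d j ≤ 2
  others j j≢i = subst (λ x → x + d j ≤ 2) (trans dᵢ≡2+extra (cong (2 +_) extra≡0))
    (ℕ.≤-trans (two-terms≤sum d i j (j≢i ∘ sym)) (ℕ.≤-reflexive total))

∣p∪q∣≤∣p∣+∣q∣ : ∀ {n} (p q : Subset n) → ∣ p ∪ q ∣ ≤ ∣ p ∣ + ∣ q ∣
∣p∪q∣≤∣p∣+∣q∣ []              []              = ℕ.≤-refl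
∣p∪q∣≤∣p∣+∣q∣ (inside  ∷ p) (inside  ∷ q) =
  s≤s (ℕ.≤-trans (∣p∪q∣≤∣p∣+∣q∣ p q) (ℕ.≤-trans (ℕ.n≤1+n _) (ℕ.≤-reflexive (sym (ℕ.+-suc ∣ p ∣ ∣ q ∣)))))
∣p∪q∣≤∣p∣+∣q∣ (inside  ∷ p) (outside ∷ q) = s≤s (∣p∪q∣≤∣p∣+∣q∣ p q)
∣p∪q∣≤∣p∣+∣q∣ (outside ∷ p) (inside  ∷ q) =
  ℕ.≤-trans (s≤s (∣p∪q∣≤∣p∣+∣q∣ p q)) (ℕ.≤-reflexive (sym (ℕ.+-suc ∣ p ∣ ∣ q ∣)))
∣p∪q∣≤∣p∣+∣q∣ (outside ∷ p) (outside ∷ q) = ∣p∪q∣≤∣p∣+∣q∣ p q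

module _ {n : ℕ} {S : Subset n} {v : Fin n} (v∈S : v ∈ S) (u : Fin n) where

  exchange : Subset n
  exchange = ⁅ u ⁆ ∪ (S - v)

  ∣exchange∣≤ : ∣ exchange ∣ ≤ ∣ S ∣
  ∣exchange∣≤ = ℕ.≤-trans (∣p∪q∣≤∣p∣+∣q∣ ⁅ u ⁆ (S - v))
    (subst (_≤ ∣ S ∣) (cong (_+ ∣ S - v ∣) (sym (∣⁅x⁆∣≡1 u))) (x∈p⇒∣p-x∣<∣p∣ v∈S))

  u∈exchange : u ∈ exchange
  u∈exchange = x∈p∪q⁺ (inj₁ (x∈⁅x⁆ u))

  exchange-keeps : ∀ {x} → x ≢ v → x ∈ S → x ∈ exchange
  exchange-keeps x≢v x∈S = x∈p∪q⁺ (inj₂ (x∈p∧x≢y⇒x∈p-y x∈S x≢v))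

filter-mono : ∀ {n} {P Q : Edge n → Set} (P? : Decidable P) (Q? : Decidable Q) {L : MGraph n} →
  All (λ e → P e → Q e) L → filter P? L ⊆ filter Q? L
filter-mono P? Q? []                      = ⊆-refl
filter-mono P? Q? {e ∷ L} (P⇒Q ∷ P⇒Qs) with P? e | Q? e
... | yes _  | yes _  = refl ∷ filter-mono P? Q? P⇒Qs
... | yes pe | no ¬qe = ⊥-elim (¬qe (P⇒Q pe))
... | no _   | yes _  = e ∷ʳ filter-mono P? Q? P⇒Qs
... | no _   | no _   = filter-mono P? Q? P⇒Qs

module _ {n : ℕ} (S : Subset n) where

  Keeps : Edge n → Set
  Keeps e = proj₁ e ∉ S × proj₂ e ∉ S

  keeps? : Decidable Keeps
  keeps? e = ¬? (proj₁ e ∈? S) ×-dec ¬? (proj₂ e ∈? S)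

  joins-keeps : ∀ {e : Edge n} {a b} → Joins e a b → a ∉ S → b ∉ S → Keeps e
  joins-keeps (inj₁ refl) a∉S b∉S = a∉S , b∉S
  joins-keeps (inj₂ refl) a∉S b∉S = b∉S , a∉S

  keeps-joins : ∀ {e : Edge n} {a b} → Keeps e → Joins e a b → b ∉ S
  keeps-joins k (inj₁ refl) = proj₂ k
  keeps-joins k (inj₂ refl) = proj₁ k

  delete-keep : ∀ {e} (L : MGraph n) → Keeps e → deleteVertices S (e ∷ L) ≡ e ∷ deleteVertices S L
  delete-keep L = filter-accept keeps?

  delete-drop : ∀ {e} (L : MGraph n) → ¬ Keeps e → deleteVertices S (e ∷ L) ≡ deleteVertices S L
  delete-drop L = filter-reject keeps?

  delete-↭ : ∀ {A B : MGraph n} → A ↭ B → deleteVertices S A ↭ deleteVertices S B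
  delete-↭ = filter-↭ keeps?

  delete-cons-⊆ : ∀ e (L : MGraph n) → deleteVertices S L ⊆ deleteVertices S (e ∷ L)
  delete-cons-⊆ e L = filter⁺ keeps? keeps? (λ { refl k → k }) (e ∷ʳ ⊆-refl)

  delete-avoids : ∀ {v} {L : MGraph n} → Avoids v L → Avoids v (deleteVertices S L)
  delete-avoids {L = L} = All-resp-⊆ (filter-⊆ keeps? L)

exchange-⊆ : ∀ {n} {S : Subset n} {v : Fin n} (v∈S : v ∈ S) (u : Fin n) {L : MGraph n} →
  Avoids v L → deleteVertices (exchange v∈S u) L ⊆ deleteVertices S L
exchange-⊆ {S = S} {v} v∈S u av = filter-mono (keeps? _) (keeps? S) (All.map kept av)
  where
  kept : ∀ {e} → ¬ Touches e v → Keeps (exchange v∈S u) e → Keeps S e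
  kept {a , b} off (a∉ , b∉) =
      (λ a∈S → a∉ (exchange-keeps v∈S u (λ { refl → off (b , inj₁ refl) }) a∈S))
    , (λ b∈S → b∉ (exchange-keeps v∈S u (λ { refl → off (a , inj₂ refl) }) b∈S))

simfvs-reflect : ∀ {α n} {G H : ColGraph α n} {S T : Subset n} →
  (∀ j → HasCycle (deleteVertices T (H j)) → HasCycle (deleteVertices S (G j))) →
  IsSimFVS G S → IsSimFVS H T
simfvs-reflect cycles fvs j = forest-reflect (cycles j) (fvs j)

module Reduction {α n : ℕ} (G G' : ColGraph α n) (i : Fin α) {v u w : Fin n}
  {e₁ e₂ : Edge n} {rest : MGraph n} (total : totalDegree G v ≡ 2)
  (Gᵢ : G i ↭ e₁ ∷ e₂ ∷ rest) (G'ᵢ : G' i ↭ (u , w) ∷ rest) (same : ∀ j → j ≢ i → G' j ≡ G j)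
  (je₁ : Joins e₁ v u) (je₂ : Joins e₂ v w) where

  private
    picture : u ≢ v × w ≢ v × Avoids v rest × (∀ j → j ≢ i → Avoids v (G j))
    picture = degree-two G i total Gᵢ je₁ je₂

    u≢v : u ≢ v
    u≢v = proj₁ picture

    w≢v : w ≢ v
    w≢v = proj₁ (proj₂ picture)

    rest-avoids : Avoids v rest
    rest-avoids = proj₁ (proj₂ (proj₂ picture))

    others-avoid : ∀ j → j ≢ i → Avoids v (G j)
    others-avoid = proj₂ (proj₂ (proj₂ picture))

    module Local (S : Subset n) = Suppression je₁ je₂ u≢v w≢v (delete-avoids S rest-avoids)

  rest⊆G'ᵢ : ∀ S → deleteVertices S rest ⊆ deleteVertices S ((u , w) ∷ rest)
  rest⊆G'ᵢ S = delete-cons-⊆ S (u , w) rest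

  rest⊆Gᵢ : ∀ S → deleteVertices S rest ⊆ deleteVertices S (e₁ ∷ e₂ ∷ rest)
  rest⊆Gᵢ S = ⊆-trans (delete-cons-⊆ S e₂ rest) (delete-cons-⊆ S e₁ _)

  -- Every cycle of G_i - S yields one of G'_i - S: depending on which of e₁, e₂
  -- survive, it avoids both, runs through a pendant edge, or is suppressed at v.
  suppress-deleted : ∀ S → HasCycle (deleteVertices S (e₁ ∷ e₂ ∷ rest)) →
    HasCycle (deleteVertices S ((u , w) ∷ rest))
  suppress-deleted S c with keeps? S e₁ | keeps? S e₂
  ... | no ¬k₁ | no ¬k₂ = cycle-⊆ (rest⊆G'ᵢ S) (subst HasCycle (trans (delete-drop S _ ¬k₁) (delete-drop S rest ¬k₂)) c)
  ... | no ¬k₁ | yes k₂ = cycle-⊆ (rest⊆G'ᵢ S) (pendant je₂ w≢v (delete-avoids S rest-avoids)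
                            (subst HasCycle (trans (delete-drop S _ ¬k₁) (delete-keep S rest k₂)) c))
  ... | yes k₁ | no ¬k₂ = cycle-⊆ (rest⊆G'ᵢ S) (pendant je₁ u≢v (delete-avoids S rest-avoids)
                            (subst HasCycle (trans (delete-keep S _ k₁) (cong (e₁ ∷_) (delete-drop S rest ¬k₂))) c))
  ... | yes k₁ | yes k₂ =
    subst HasCycle (sym (delete-keep S rest (keeps-joins S k₁ je₁ , keeps-joins S k₂ je₂)))
      (Local.suppress S (subst HasCycle (trans (delete-keep S _ k₁) (cong (e₁ ∷_) (delete-keep S rest k₂))) c))

  -- For v ∉ S, every cycle of G'_i - S yields one of G_i - S: if uw survives it
  -- is subdivided by v, otherwise the cycle already lies in rest - S.
  subdivide-deleted : ∀ S → v ∉ S → HasCycle (deleteVertices S ((u , w) ∷ rest)) →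
    HasCycle (deleteVertices S (e₁ ∷ e₂ ∷ rest))
  subdivide-deleted S v∉S c with keeps? S (u , w)
  ... | no ¬k = cycle-⊆ (rest⊆Gᵢ S) (subst HasCycle (delete-drop S rest ¬k) c)
  ... | yes (u∉S , w∉S) =
    subst HasCycle (sym (trans (delete-keep S _ (joins-keeps S je₁ v∉S u∉S))
                               (cong (e₁ ∷_) (delete-keep S rest (joins-keeps S je₂ v∉S w∉S)))))
      (Local.subdivide S (subst HasCycle (delete-keep S rest (u∉S , w∉S)) c))

  -- A feedback set of G' is one of G: suppression keeps cycles.
  fvs-G'⇒G : ∀ S → IsSimFVS G' S → IsSimFVS G S
  fvs-G'⇒G S = simfvs-reflect {G = G'} {H = G} cycles
    where
    cycles : ∀ j → HasCycle (deleteVertices S (G j)) → HasCycle (deleteVertices S (G' j))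
    cycles j with j ≟ i
    ... | yes refl = cycle-↭ (delete-↭ S (↭-sym G'ᵢ)) ∘ suppress-deleted S ∘ cycle-↭ (delete-↭ S Gᵢ)
    ... | no j≢i = subst (HasCycle ∘ deleteVertices S) (sym (same j j≢i))

  -- A feedback set of G avoiding v is one of G': subdivision keeps cycles.
  fvs-G⇒G'-off-v : ∀ S → v ∉ S → IsSimFVS G S → IsSimFVS G' S
  fvs-G⇒G'-off-v S v∉S = simfvs-reflect {G = G} {H = G'} cycles
    where
    cycles : ∀ j → HasCycle (deleteVertices S (G' j)) → HasCycle (deleteVertices S (G j))
    cycles j with j ≟ i
    ... | yes refl = cycle-↭ (delete-↭ S (↭-sym Gᵢ)) ∘ subdivide-deleted S v∉S ∘ cycle-↭ (delete-↭ S G'ᵢ)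
    ... | no j≢i = subst (HasCycle ∘ deleteVertices S) (same j j≢i)

  -- A feedback set of G containing v, with v exchanged for u, is one of G':
  -- the edge uw is deleted, and elsewhere the exchange deletes at least as much.
  fvs-G⇒G'-at-v : ∀ S (v∈S : v ∈ S) → IsSimFVS G S → IsSimFVS G' (exchange v∈S u)
  fvs-G⇒G'-at-v S v∈S = simfvs-reflect {G = G} {H = G'} cycles
    where
    T : Subset n
    T = exchange v∈S u
    cycles : ∀ j → HasCycle (deleteVertices T (G' j)) → HasCycle (deleteVertices S (G j))
    cycles j with j ≟ i
    ... | yes refl =
      cycle-↭ (delete-↭ S (↭-sym Gᵢ))
      ∘ cycle-⊆ (⊆-trans (exchange-⊆ v∈S u rest-avoids) (rest⊆Gᵢ S))
      ∘ subst HasCycle (delete-drop T rest (λ k → proj₁ k (u∈exchange v∈S u)))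
      ∘ cycle-↭ (delete-↭ T G'ᵢ)
    ... | no j≢i = cycle-⊆ (exchange-⊆ v∈S u (others-avoid j j≢i))
                   ∘ subst (HasCycle ∘ deleteVertices T) (same j j≢i)

  fvs-G⇒G' : ∀ S → IsSimFVS G S → Σ (Subset n) (λ T → IsSimFVS G' T × ∣ T ∣ ≤ ∣ S ∣)
  fvs-G⇒G' S fvs with v ∈? S
  ... | yes v∈S = exchange v∈S u , fvs-G⇒G'-at-v S v∈S fvs , ∣exchange∣≤ v∈S u
  ... | no v∉S  = S , fvs-G⇒G'-off-v S v∉S fvs , ℕ.≤-refl

lemma2 : ∀ {α n} (G G' : ColGraph α n) (k : ℕ) → 0 < k →
    (v u w : Fin n) (i : Fin α) (e₁ e₂ : Edge n) (rest : MGraph n) →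
    totalDegree G v ≡ 2 →
    G i ↭ e₁ ∷ e₂ ∷ rest → Joins e₁ v u → Joins e₂ v w → u ≢ w →
    G' i ↭ (u , w) ∷ rest → (∀ j → j ≢ i → G' j ≡ G j) →
    (Σ (Subset n) (λ S → IsSimFVS G S × ∣ S ∣ ≤ k))
    ⇔ (Σ (Subset n) (λ S → IsSimFVS G' S × ∣ S ∣ ≤ k))
lemma2 {n = n} G G' k _ v u w i e₁ e₂ rest total Gᵢ je₁ je₂ _ G'ᵢ same = mk⇔ forward backward
  where
  open Reduction G G' i total Gᵢ G'ᵢ same je₁ je₂

  forward : Σ (Subset n) (λ S → IsSimFVS G S × ∣ S ∣ ≤ k) → Σ (Subset n) (λ S → IsSimFVS G' S × ∣ S ∣ ≤ k)
  forward (S , fvs , ∣S∣≤k) with fvs-G⇒G' S fvs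
  ... | T , fvs' , ∣T∣≤∣S∣ = T , fvs' , ℕ.≤-trans ∣T∣≤∣S∣ ∣S∣≤k

  backward : Σ (Subset n) (λ S → IsSimFVS G' S × ∣ S ∣ ≤ k) → Σ (Subset n) (λ S → IsSimFVS G S × ∣ S ∣ ≤ k)
  backward (S , fvs , ∣S∣≤k) = S , fvs-G'⇒G S fvs , ∣S∣≤k
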